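{- Let $n\ge1$, $p$ a prime, $S\subset E_n$, and let $(T^{(s)})_{s\in S}$ be any family of subsets of $E_n$. Then the $|S|$ linear forms $F^{(s)}_{T^{(s)}}\colon\mathbb{Q}^n\to\mathbb{Q}$, $s\in S$, defining the $S$-adapted $p$-cone $\{x\in\mathbb{Z}^n:F^{(s)}_{T^{(s)}}(x)\le0\ \forall s\in S\}$ are linearly independent over $\mathbb{Q}$.
   Context: $E_n=\{1,\dots,n\}$, indices mod $n$; $\delta_T^{(m)}=-1$ if $m\in T$, $1$ otherwise; $F^{(d)}_T(x)=\sum_{j=0}^{n-1}p^j\delta_T^{(d+j)}x_{d+j}$. -}

module Defs where

open import Data.Nat as ℕ using (ℕ; zero; suc; NonZero; _^_)
open import Data.Nat.DivMod using (_mod_)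
open import Data.Fin using (Fin; toℕ)
open import Data.Fin.Subset using (Subset; _∈_)
open import Data.Fin.Subset.Properties using (_∈?_)
open import Data.Integer using (+_)
open import Data.Rational using (ℚ; 0ℚ; 1ℚ; _+_; _*_; -_; _/_)
open import Data.Bool using (if_then_else_)
open import Relation.Nullary using (does)

-- Convention: E_n = {1,…,n} is represented by Fin n = {0,…,n-1}
-- (element m ∈ E_n ↔ index m-1); indices mod n accordingly.

Σ< : ℕ → (ℕ → ℚ) → ℚ
Σ< zero    f = 0ℚ
Σ< (suc k) f = Σ< k f + f k

ΣFin : (n : ℕ) → (Fin n → ℚ) → ℚ
ΣFin zero    f = 0ℚ
ΣFin (suc n) f = f Fin.zero + ΣFin n (λ i → f (Fin.suc i))
  where import Data.Fin as Fin

ℕ→ℚ : ℕ → ℚ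
ℕ→ℚ k = (+ k) / 1

shift : (n : ℕ) .{{_ : NonZero n}} → Fin n → ℕ → Fin n
shift n d j = (toℕ d ℕ.+ j) mod n

δ : ∀ {n} → Subset n → Fin n → ℚ
δ T m = if does (m ∈? T) then - 1ℚ else 1ℚ

F : (n p : ℕ) .{{_ : NonZero n}} → Fin n → Subset n → (Fin n → ℚ) → ℚ
F n p d T x = Σ< n (λ j → ℕ→ℚ (p ^ j) * (δ T (shift n d j) * x (shift n d j)))

LinIndepForms : (n : ℕ) → Subset n → (Fin n → ((Fin n → ℚ) → ℚ)) → Set
LinIndepForms n S G =
  (c : Fin n → ℚ) →
  ((x : Fin n → ℚ) → ΣFin n (λ s → if does (s ∈? S) then c s * G s x else 0ℚ) ≡ 0ℚ) →
  (s : Fin n) → s ∈ S → c s ≡ 0ℚ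
  where open import Relation.Binary.PropositionalEquality using (_≡_)

{-# OPTIONS --safe #-}
-- Evaluate a vanishing combination Σ_s c_s F^{(s)} at the basis vector e_m. Modulo p only the
-- j = 0 terms survive, and of those only s = m, so c_m = ± p · (a ℤ-combination of the c_s).
-- Thus every element of the ℤ-span of the coefficients is p times another one, hence divisible
-- by every power of p; as the span has a common denominator, all coefficients vanish.
module Submission where

open import Defs
open import Data.Nat using (ℕ; NonZero)
open import Data.Nat.Primality using (Prime; prime⇒nonTrivial)
open import Data.Fin using (Fin)
open import Data.Fin.Subset using (Subset; _∈_)

open import Data.Nat as ℕ using (zero; suc; _^_; _<_; z<s)
import Data.Nat.Properties as ℕ
open import Data.Nat.Divisibility using (_∣_; divides; ∣⇒≤)
open import Data.Nat.DivMod using (m<n⇒m%n≡m)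
open import Data.Nat.ListAction using (product)
open import Data.Nat.ListAction.Properties using (∈⇒∣product; product≢0)
import Data.Fin as Fin
import Data.Fin.Properties as Fin
open import Data.Fin.Subset.Properties using (_∈?_)
open import Data.Integer as ℤ using (ℤ; +_)
import Data.Integer.Properties as ℤ
open import Data.Rational using (ℚ; 0ℚ; 1ℚ; _+_; _*_; -_; _/_; toℚᵘ; ↥_; ↧ₙ_)
open import Data.Rational.Properties
  using (toℚᵘ-injective; toℚᵘ-cong; toℚᵘ-fromℚᵘ; toℚᵘ-homo-+; toℚᵘ-homo-*; toℚᵘ-homo‿-;
         ↥p≡0⇒p≡0; *-zeroˡ; +-*-commutativeRing)
import Data.Rational.Unnormalised as ℚᵘ
import Data.Rational.Unnormalised.Properties as ℚᵘ
open import Data.Rational.Solver using (module +-*-Solver)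
open import Data.List using (tabulate)
open import Data.List.Membership.Propositional.Properties using (∈-tabulate⁺)
import Data.List.Relation.Unary.All.Properties as All
open import Data.Product using (Σ; _,_; _×_)
open import Data.Sum using ([_,_]′)
open import Data.Bool using (true; false; if_then_else_)
open import Relation.Nullary using (does; yes; no)
open import Relation.Nullary.Negation using (contradiction)
open import Relation.Binary.PropositionalEquality
open import Algebra.Bundles using (CommutativeRing)
open import Algebra.Properties.Semiring.Sum (CommutativeRing.semiring +-*-commutativeRing)
  using (sum; ∑-distrib-+; *-distribʳ-sum)

open +-*-Solver

ι : ℤ → ℚ
ι z = z / 1

Integral : ℚ → Set
Integral q = Σ ℤ λ z → q ≡ ι z

toℚᵘ-ι : ∀ z → toℚᵘ (ι z) ℚᵘ.≃ ℚᵘ.mkℚᵘ z 0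
toℚᵘ-ι z = toℚᵘ-fromℚᵘ (ℚᵘ.mkℚᵘ z 0)

ι-homo-+ : ∀ a b → ι a + ι b ≡ ι (a ℤ.+ b)
ι-homo-+ a b = toℚᵘ-injective (begin
  toℚᵘ (ι a + ι b)              ≈⟨ toℚᵘ-homo-+ (ι a) (ι b) ⟩
  toℚᵘ (ι a) ℚᵘ.+ toℚᵘ (ι b)    ≈⟨ ℚᵘ.+-cong (toℚᵘ-ι a) (toℚᵘ-ι b) ⟩
  ℚᵘ.mkℚᵘ a 0 ℚᵘ.+ ℚᵘ.mkℚᵘ b 0  ≈⟨ ℚᵘ.*≡* (trans (ℤ.*-identityʳ _)
                                     (trans (cong₂ ℤ._+_ (ℤ.*-identityʳ a) (ℤ.*-identityʳ b)) (sym (ℤ.*-identityʳ _)))) ⟩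
  ℚᵘ.mkℚᵘ (a ℤ.+ b) 0           ≈⟨ ℚᵘ.≃-sym (toℚᵘ-ι (a ℤ.+ b)) ⟩
  toℚᵘ (ι (a ℤ.+ b))            ∎)
  where open ℚᵘ.≃-Reasoning

ι-homo-* : ∀ a b → ι a * ι b ≡ ι (a ℤ.* b)
ι-homo-* a b = toℚᵘ-injective (begin
  toℚᵘ (ι a * ι b)              ≈⟨ toℚᵘ-homo-* (ι a) (ι b) ⟩
  toℚᵘ (ι a) ℚᵘ.* toℚᵘ (ι b)    ≈⟨ ℚᵘ.*-cong (toℚᵘ-ι a) (toℚᵘ-ι b) ⟩
  ℚᵘ.mkℚᵘ (a ℤ.* b) 0           ≈⟨ ℚᵘ.≃-sym (toℚᵘ-ι (a ℤ.* b)) ⟩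
  toℚᵘ (ι (a ℤ.* b))            ∎)
  where open ℚᵘ.≃-Reasoning

ι-homo‿- : ∀ a → - ι a ≡ ι (ℤ.- a)
ι-homo‿- a = toℚᵘ-injective (begin
  toℚᵘ (- ι a)       ≈⟨ toℚᵘ-homo‿- (ι a) ⟩
  ℚᵘ.- toℚᵘ (ι a)    ≈⟨ ℚᵘ.-‿cong (toℚᵘ-ι a) ⟩
  ℚᵘ.mkℚᵘ (ℤ.- a) 0  ≈⟨ ℚᵘ.≃-sym (toℚᵘ-ι (ℤ.- a)) ⟩
  toℚᵘ (ι (ℤ.- a))   ∎)
  where open ℚᵘ.≃-Reasoning

ι-injective : ∀ {a b} → ι a ≡ ι b → a ≡ b
ι-injective {a} {b} eq with ℚᵘ.≃-trans (ℚᵘ.≃-sym (toℚᵘ-ι a)) (ℚᵘ.≃-trans (toℚᵘ-cong eq) (toℚᵘ-ι b))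
... | ℚᵘ.*≡* a*1≡b*1 = trans (sym (ℤ.*-identityʳ a)) (trans a*1≡b*1 (ℤ.*-identityʳ b))

ι↧p*p≡ι↥p : ∀ p → ι (+ ↧ₙ p) * p ≡ ι (↥ p)
ι↧p*p≡ι↥p p@record{} = toℚᵘ-injective (begin
  toℚᵘ (ι (+ ↧ₙ p) * p)                  ≈⟨ toℚᵘ-homo-* (ι (+ ↧ₙ p)) p ⟩
  toℚᵘ (ι (+ ↧ₙ p)) ℚᵘ.* toℚᵘ p          ≈⟨ ℚᵘ.*-congʳ (toℚᵘ-ι (+ ↧ₙ p)) ⟩
  ℚᵘ.mkℚᵘ (+ ↧ₙ p) 0 ℚᵘ.* toℚᵘ p         ≈⟨ ℚᵘ.*≡* (trans (ℤ.*-identityʳ _)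
                                               (trans (ℤ.*-comm (+ ↧ₙ p) (↥ p)) (cong (↥ p ℤ.*_) (sym (ℤ.*-identityˡ _))))) ⟩
  ℚᵘ.mkℚᵘ (↥ p) 0                        ≈⟨ ℚᵘ.≃-sym (toℚᵘ-ι (↥ p)) ⟩
  toℚᵘ (ι (↥ p))                         ∎)
  where open ℚᵘ.≃-Reasoning

ℕ→ℚ-homo-* : ∀ a b → ℕ→ℚ (a ℕ.* b) ≡ ℕ→ℚ a * ℕ→ℚ b
ℕ→ℚ-homo-* a b = trans (cong ι (ℤ.pos-* a b)) (sym (ι-homo-* (+ a) (+ b)))

d*a≡0⇒a≡0 : ∀ d .{{_ : NonZero d}} {a} → ℕ→ℚ d * a ≡ 0ℚ → a ≡ 0ℚ
d*a≡0⇒a≡0 d {a} d*a≡0 =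
  [ (λ d≡0 → contradiction (ℤ.+-injective d≡0) (ℕ.≢-nonZero⁻¹ d)) , ↥p≡0⇒p≡0 a ]′
    (ℤ.i*j≡0⇒i≡0∨j≡0 (+ d) (ι-injective (begin
      ι (+ d ℤ.* ↥ a)               ≡⟨ sym (ι-homo-* (+ d) (↥ a)) ⟩
      ℕ→ℚ d * ι (↥ a)               ≡⟨ cong (ℕ→ℚ d *_) (sym (ι↧p*p≡ι↥p a)) ⟩
      ℕ→ℚ d * (ι (+ ↧ₙ a) * a)      ≡⟨ solve 3 (λ d e a → d :* (e :* a) := e :* (d :* a)) refl (ℕ→ℚ d) (ι (+ ↧ₙ a)) a ⟩
      ι (+ ↧ₙ a) * (ℕ→ℚ d * a)      ≡⟨ cong (ι (+ ↧ₙ a) *_) d*a≡0 ⟩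
      ι (+ ↧ₙ a) * 0ℚ               ≡⟨ solve 1 (λ e → e :* con 0ℚ := con 0ℚ) refl (ι (+ ↧ₙ a)) ⟩
      ι (+ 0)                       ∎)))
  where open ≡-Reasoning

integral-+ : ∀ {a b} → Integral a → Integral b → Integral (a + b)
integral-+ (x , refl) (y , refl) = x ℤ.+ y , ι-homo-+ x y

integral-* : ∀ {a b} → Integral a → Integral b → Integral (a * b)
integral-* (x , refl) (y , refl) = x ℤ.* y , ι-homo-* x y

integral-neg : ∀ {a} → Integral a → Integral (- a)
integral-neg (x , refl) = ℤ.- x , ι-homo‿- x

integral-0 : Integral 0ℚ
integral-0 = + 0 , refl

integral-1 : Integral 1ℚ
integral-1 = + 1 , refl

integral-ℕ→ℚ : ∀ k → Integral (ℕ→ℚ k)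
integral-ℕ→ℚ k = + k , refl

integral-Σ< : ∀ k {f} → (∀ j → Integral (f j)) → Integral (Σ< k f)
integral-Σ< zero    f-int = integral-0
integral-Σ< (suc k) f-int = integral-+ (integral-Σ< k f-int) (f-int k)

n<p^n : ∀ {p} → 1 < p → ∀ n → n < p ^ n
n<p^n             1<p zero    = z<s
n<p^n {p@(suc _)} 1<p (suc n) = ℕ.≤-<-trans (n<p^n 1<p n)
  (subst (p ^ n <_) (ℕ.*-comm (p ^ n) p) (ℕ.m<m*n (p ^ n) p {{ℕ.m^n≢0 p n}} 1<p))

p^n∣n⇒n≡0 : ∀ {p} → 1 < p → ∀ n → p ^ n ∣ n → n ≡ 0
p^n∣n⇒n≡0 1<p zero    _   = refl
p^n∣n⇒n≡0 1<p (suc n) p^n∣n = contradiction (∣⇒≤ p^n∣n) (ℕ.<⇒≱ (n<p^n 1<p (suc n)))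

divisible-by-all-powers⇒zero : ∀ {p} → 1 < p → ∀ {u} → (∀ j → Σ ℤ λ N → u ≡ ℕ→ℚ (p ^ j) * ι N) → u ≡ 0ℚ
divisible-by-all-powers⇒zero {p} 1<p {u} u∈pʲℤ with u∈pʲℤ 0
... | Z , u≡1*Z with u∈pʲℤ ℤ.∣ Z ∣
... | N , u≡pᶻN = trans u≡Z (cong ι (ℤ.∣i∣≡0⇒i≡0 {Z} (p^n∣n⇒n≡0 1<p ℤ.∣ Z ∣ p^∣Z∣∣Z)))
  where
  u≡Z : u ≡ ι Z
  u≡Z = trans u≡1*Z (solve 1 (λ z → con 1ℚ :* z := z) refl (ι Z))
  Z≡pᶻN : Z ≡ + (p ^ ℤ.∣ Z ∣) ℤ.* N
  Z≡pᶻN = ι-injective (trans (sym u≡Z) (trans u≡pᶻN (ι-homo-* (+ (p ^ ℤ.∣ Z ∣)) N)))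
  p^∣Z∣∣Z : p ^ ℤ.∣ Z ∣ ∣ ℤ.∣ Z ∣
  p^∣Z∣∣Z = divides ℤ.∣ N ∣
    (trans (cong ℤ.∣_∣ Z≡pᶻN) (trans (ℤ.abs-* (+ (p ^ ℤ.∣ Z ∣)) N) (ℕ.*-comm (p ^ ℤ.∣ Z ∣) ℤ.∣ N ∣)))

data ℤSpan {k} (g : Fin k → ℚ) : ℚ → Set where
  gen   : ∀ i → ℤSpan g (g i)
  zero  : ℤSpan g 0ℚ
  _+ₛ_  : ∀ {a b} → ℤSpan g a → ℤSpan g b → ℤSpan g (a + b)
  _*ₛ_  : ∀ {a z} → ℤSpan g a → Integral z → ℤSpan g (a * z)

_·ℤSpan_ : ∀ {k} → ℚ → (Fin k → ℚ) → ℚ → Set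
(q ·ℤSpan g) a = Σ ℚ λ b → ℤSpan g b × a ≡ q * b

commonDenominator : ∀ {k} → (Fin k → ℚ) → ℕ
commonDenominator g = product (tabulate (λ i → ↧ₙ g i))

commonDenominator-nonZero : ∀ {k} (g : Fin k → ℚ) → NonZero (commonDenominator g)
commonDenominator-nonZero g = product≢0 (All.tabulate⁺ (λ i → ↧ₙ-nonZero (g i)))
  where
  ↧ₙ-nonZero : ∀ q → NonZero (↧ₙ q)
  ↧ₙ-nonZero record{} = _

module _ {k} {g : Fin k → ℚ} where

  ℤSpan-ΣFin : ∀ n {f} → (∀ i → ℤSpan g (f i)) → ℤSpan g (ΣFin n f)
  ℤSpan-ΣFin zero    f∈ = zero
  ℤSpan-ΣFin (suc n) f∈ = f∈ Fin.zero +ₛ ℤSpan-ΣFin n (λ i → f∈ (Fin.suc i))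

  ·ℤSpan-closed : ∀ {q} → (∀ i → (q ·ℤSpan g) (g i)) → ∀ {a} → ℤSpan g a → (q ·ℤSpan g) a
  ·ℤSpan-closed {q} g∈ (gen i) = g∈ i
  ·ℤSpan-closed {q} g∈ zero = 0ℚ , zero , solve 1 (λ q → con 0ℚ := q :* con 0ℚ) refl q
  ·ℤSpan-closed {q} g∈ (a∈ +ₛ b∈) with ·ℤSpan-closed {q} g∈ a∈ | ·ℤSpan-closed {q} g∈ b∈
  ... | a′ , a′∈ , refl | b′ , b′∈ , refl =
    a′ + b′ , a′∈ +ₛ b′∈ , solve 3 (λ q a b → q :* a :+ q :* b := q :* (a :+ b)) refl q a′ b′
  ·ℤSpan-closed {q} g∈ (_*ₛ_ {z = z} a∈ z-int) with ·ℤSpan-closed {q} g∈ a∈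
  ... | a′ , a′∈ , refl = a′ * z , a′∈ *ₛ z-int , solve 3 (λ q a z → q :* a :* z := q :* (a :* z)) refl q a′ z

  ·ℤSpan-pow : ∀ {p} → (∀ i → (ℕ→ℚ p ·ℤSpan g) (g i)) →
               ∀ j {a} → ℤSpan g a → (ℕ→ℚ (p ^ j) ·ℤSpan g) a
  ·ℤSpan-pow {p} g∈ zero    {a} a∈ = a , a∈ , solve 1 (λ a → a := con 1ℚ :* a) refl a
  ·ℤSpan-pow {p} g∈ (suc j) a∈ with ·ℤSpan-closed {ℕ→ℚ p} g∈ a∈
  ... | a′ , a′∈ , refl with ·ℤSpan-pow {p} g∈ j a′∈
  ... | b , b∈ , refl = b , b∈ , (begin
    ℕ→ℚ p * (ℕ→ℚ (p ^ j) * b)    ≡⟨ solve 3 (λ p q b → p :* (q :* b) := p :* q :* b) refl (ℕ→ℚ p) (ℕ→ℚ (p ^ j)) b ⟩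
    ℕ→ℚ p * ℕ→ℚ (p ^ j) * b      ≡⟨ cong (_* b) (sym (ℕ→ℚ-homo-* p (p ^ j))) ⟩
    ℕ→ℚ (p ^ suc j) * b          ∎)
    where open ≡-Reasoning

  private
    D : ℕ
    D = commonDenominator g
    instance
      D-nonZero : NonZero D
      D-nonZero = commonDenominator-nonZero g

  commonDenominator-clears-gen : ∀ i → Integral (ℕ→ℚ D * g i)
  commonDenominator-clears-gen i with ∈⇒∣product (∈-tabulate⁺ {f = λ i → ↧ₙ g i} i)
  ... | divides q D≡q*↧ = + q ℤ.* ↥ g i , (begin
    ℕ→ℚ D * g i                         ≡⟨ cong (λ d → ℕ→ℚ d * g i) D≡q*↧ ⟩
    ℕ→ℚ (q ℕ.* ↧ₙ g i) * g i            ≡⟨ cong (_* g i) (ℕ→ℚ-homo-* q (↧ₙ g i)) ⟩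
    ℕ→ℚ q * ℕ→ℚ (↧ₙ g i) * g i          ≡⟨ solve 3 (λ q d x → q :* d :* x := q :* (d :* x)) refl (ℕ→ℚ q) (ℕ→ℚ (↧ₙ g i)) (g i) ⟩
    ℕ→ℚ q * (ℕ→ℚ (↧ₙ g i) * g i)        ≡⟨ cong (ℕ→ℚ q *_) (ι↧p*p≡ι↥p (g i)) ⟩
    ι (+ q) * ι (↥ g i)                 ≡⟨ ι-homo-* (+ q) (↥ g i) ⟩
    ι (+ q ℤ.* ↥ g i)                   ∎)
    where open ≡-Reasoning

  commonDenominator-clears : ∀ {a} → ℤSpan g a → Integral (ℕ→ℚ D * a)
  commonDenominator-clears (gen i) = commonDenominator-clears-gen i
  commonDenominator-clears zero =
    subst Integral (solve 1 (λ d → con 0ℚ := d :* con 0ℚ) refl (ℕ→ℚ D)) integral-0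
  commonDenominator-clears (_+ₛ_ {a} {b} a∈ b∈) =
    subst Integral (solve 3 (λ d a b → d :* a :+ d :* b := d :* (a :+ b)) refl (ℕ→ℚ D) a b)
      (integral-+ (commonDenominator-clears a∈) (commonDenominator-clears b∈))
  commonDenominator-clears (_*ₛ_ {a} {z} a∈ z-int) =
    subst Integral (solve 3 (λ d a z → d :* a :* z := d :* (a :* z)) refl (ℕ→ℚ D) a z)
      (integral-* (commonDenominator-clears a∈) z-int)

  ·ℤSpan-generators⇒zero : ∀ {p} → 1 < p → (∀ i → (ℕ→ℚ p ·ℤSpan g) (g i)) → ∀ i → g i ≡ 0ℚ
  ·ℤSpan-generators⇒zero {p} 1<p g∈ i = d*a≡0⇒a≡0 D (divisible-by-all-powers⇒zero 1<p Dgᵢ∈pʲℤ)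
    where
    Dgᵢ∈pʲℤ : ∀ j → Σ ℤ λ N → ℕ→ℚ D * g i ≡ ℕ→ℚ (p ^ j) * ι N
    Dgᵢ∈pʲℤ j with ·ℤSpan-pow g∈ j (gen i)
    ... | b , b∈ , gᵢ≡pʲb with commonDenominator-clears b∈
    ... | N , Db≡N = N , (begin
      ℕ→ℚ D * g i                  ≡⟨ cong (ℕ→ℚ D *_) gᵢ≡pʲb ⟩
      ℕ→ℚ D * (ℕ→ℚ (p ^ j) * b)    ≡⟨ solve 3 (λ d q b → d :* (q :* b) := q :* (d :* b)) refl (ℕ→ℚ D) (ℕ→ℚ (p ^ j)) b ⟩
      ℕ→ℚ (p ^ j) * (ℕ→ℚ D * b)    ≡⟨ cong (ℕ→ℚ (p ^ j) *_) Db≡N ⟩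
      ℕ→ℚ (p ^ j) * ι N            ∎)
      where open ≡-Reasoning

ΣFin≡sum : ∀ n (f : Fin n → ℚ) → ΣFin n f ≡ sum f
ΣFin≡sum zero    f = refl
ΣFin≡sum (suc n) f = cong (_+_ (f Fin.zero)) (ΣFin≡sum n (λ i → f (Fin.suc i)))

ΣFin-cong : ∀ n {f g : Fin n → ℚ} → (∀ i → f i ≡ g i) → ΣFin n f ≡ ΣFin n g
ΣFin-cong zero    f≗g = refl
ΣFin-cong (suc n) f≗g = cong₂ _+_ (f≗g Fin.zero) (ΣFin-cong n (λ i → f≗g (Fin.suc i)))

ΣFin-distrib-+ : ∀ n (f g : Fin n → ℚ) → ΣFin n (λ i → f i + g i) ≡ ΣFin n f + ΣFin n g
ΣFin-distrib-+ n f g = begin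
  ΣFin n (λ i → f i + g i)   ≡⟨ ΣFin≡sum n _ ⟩
  sum (λ i → f i + g i)      ≡⟨ ∑-distrib-+ f g ⟩
  sum f + sum g              ≡⟨ sym (cong₂ _+_ (ΣFin≡sum n f) (ΣFin≡sum n g)) ⟩
  ΣFin n f + ΣFin n g        ∎
  where open ≡-Reasoning

ΣFin-*ʳ : ∀ n (f : Fin n → ℚ) a → ΣFin n (λ i → f i * a) ≡ ΣFin n f * a
ΣFin-*ʳ n f a = begin
  ΣFin n (λ i → f i * a)   ≡⟨ ΣFin≡sum n _ ⟩
  sum (λ i → f i * a)      ≡⟨ sym (*-distribʳ-sum a f) ⟩
  sum f * a                ≡⟨ sym (cong (_* a) (ΣFin≡sum n f)) ⟩
  ΣFin n f * a             ∎
  where open ≡-Reasoning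

basis : ∀ {n} → Fin n → Fin n → ℚ
basis Fin.zero    Fin.zero    = 1ℚ
basis Fin.zero    (Fin.suc _) = 0ℚ
basis (Fin.suc _) Fin.zero    = 0ℚ
basis (Fin.suc m) (Fin.suc i) = basis m i

basis-integral : ∀ {n} (m i : Fin n) → Integral (basis m i)
basis-integral Fin.zero    Fin.zero    = integral-1
basis-integral Fin.zero    (Fin.suc _) = integral-0
basis-integral (Fin.suc _) Fin.zero    = integral-0
basis-integral (Fin.suc m) (Fin.suc i) = basis-integral m i

ΣFin-basis : ∀ n (f : Fin n → ℚ) m → ΣFin n (λ i → f i * basis m i) ≡ f m
ΣFin-basis (suc n) f Fin.zero = begin
  f Fin.zero * 1ℚ + ΣFin n (λ i → f (Fin.suc i) * 0ℚ)  ≡⟨ cong (_+_ (f Fin.zero * 1ℚ)) (ΣFin-*ʳ n _ 0ℚ) ⟩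
  f Fin.zero * 1ℚ + ΣFin n (λ i → f (Fin.suc i)) * 0ℚ  ≡⟨ solve 2 (λ a b → a :* con 1ℚ :+ b :* con 0ℚ := a) refl (f Fin.zero) (ΣFin n (λ i → f (Fin.suc i))) ⟩
  f Fin.zero                                           ∎
  where open ≡-Reasoning
ΣFin-basis (suc n) f (Fin.suc m) = begin
  f Fin.zero * 0ℚ + ΣFin n (λ i → f (Fin.suc i) * basis m i)  ≡⟨ cong (_+_ (f Fin.zero * 0ℚ)) (ΣFin-basis n (λ i → f (Fin.suc i)) m) ⟩
  f Fin.zero * 0ℚ + f (Fin.suc m)                             ≡⟨ solve 2 (λ a b → a :* con 0ℚ :+ b := b) refl (f Fin.zero) (f (Fin.suc m)) ⟩
  f (Fin.suc m)                                               ∎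
  where open ≡-Reasoning

δ-integral : ∀ {n} (T : Subset n) m → Integral (δ T m)
δ-integral T m with does (m ∈? T)
... | true  = integral-neg integral-1
... | false = integral-1

δ*δ≡1 : ∀ {n} (T : Subset n) m → δ T m * δ T m ≡ 1ℚ
δ*δ≡1 T m with does (m ∈? T)
... | true  = refl
... | false = refl

shift-zero : ∀ {k} (s : Fin (suc k)) → shift (suc k) s 0 ≡ s
shift-zero {k} s = Fin.toℕ-injective (begin
  Fin.toℕ (shift (suc k) s 0)   ≡⟨ Fin.toℕ-fromℕ< _ ⟩
  (Fin.toℕ s ℕ.+ 0) ℕ.% suc k   ≡⟨ cong (ℕ._% suc k) (ℕ.+-identityʳ (Fin.toℕ s)) ⟩
  Fin.toℕ s ℕ.% suc k           ≡⟨ m<n⇒m%n≡m (Fin.toℕ<n s) ⟩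
  Fin.toℕ s                     ∎)
  where open ≡-Reasoning

Σ<-powers-unfold : ∀ p k (f : ℕ → ℚ) →
  Σ< (suc k) (λ j → ℕ→ℚ (p ^ j) * f j) ≡ f 0 + ℕ→ℚ p * Σ< k (λ j → ℕ→ℚ (p ^ j) * f (suc j))
Σ<-powers-unfold p zero    f = solve 2 (λ a p → con 0ℚ :+ con 1ℚ :* a := a :+ p :* con 0ℚ) refl (f 0) (ℕ→ℚ p)
Σ<-powers-unfold p (suc k) f = begin
  Σ< (suc k) (λ j → ℕ→ℚ (p ^ j) * f j) + ℕ→ℚ (p ^ suc k) * f (suc k)
    ≡⟨ cong₂ _+_ (Σ<-powers-unfold p k f) (cong (_* f (suc k)) (ℕ→ℚ-homo-* p (p ^ k))) ⟩
  (f 0 + ℕ→ℚ p * rest) + ℕ→ℚ p * ℕ→ℚ (p ^ k) * f (suc k)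
    ≡⟨ solve 5 (λ a p r q b → (a :+ p :* r) :+ p :* q :* b := a :+ p :* (r :+ q :* b)) refl (f 0) (ℕ→ℚ p) rest (ℕ→ℚ (p ^ k)) (f (suc k)) ⟩
  f 0 + ℕ→ℚ p * (rest + ℕ→ℚ (p ^ k) * f (suc k))
    ∎
  where
  open ≡-Reasoning
  rest : ℚ
  rest = Σ< k (λ j → ℕ→ℚ (p ^ j) * f (suc j))

Ftail : ∀ k (p : ℕ) → Fin (suc k) → Subset (suc k) → (Fin (suc k) → ℚ) → ℚ
Ftail k p d T x = Σ< k (λ j → ℕ→ℚ (p ^ j) * (δ T (shift (suc k) d (suc j)) * x (shift (suc k) d (suc j))))

F-unfold : ∀ k p d T x → F (suc k) p d T x ≡ δ T d * x d + ℕ→ℚ p * Ftail k p d T x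
F-unfold k p d T x = trans (Σ<-powers-unfold p k (λ j → δ T (shift (suc k) d j) * x (shift (suc k) d j)))
  (cong (λ t → δ T t * x t + ℕ→ℚ p * Ftail k p d T x) (shift-zero d))

Ftail-integral : ∀ k p d T {x} → (∀ i → Integral (x i)) → Integral (Ftail k p d T x)
Ftail-integral k p d T {x} x-int = integral-Σ< k term-integral
  where
  dⱼ : ℕ → Fin (suc k)
  dⱼ j = shift (suc k) d (suc j)
  term-integral : ∀ j → Integral (ℕ→ℚ (p ^ j) * (δ T (dⱼ j) * x (dⱼ j)))
  term-integral j = integral-* (integral-ℕ→ℚ (p ^ j)) (integral-* (δ-integral T (dⱼ j)) (x-int (dⱼ j)))

vanishing-combination⇒·ℤSpan : ∀ k p (T : Fin (suc k) → Subset (suc k)) (c : Fin (suc k) → ℚ) →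
  (∀ x → ΣFin (suc k) (λ s → c s * F (suc k) p s (T s) x) ≡ 0ℚ) →
  ∀ m → (ℕ→ℚ p ·ℤSpan c) (c m)
vanishing-combination⇒·ℤSpan k p T c vanishes m =
  Σtail * - δₘ , ℤSpan-ΣFin (suc k) tail∈ *ₛ integral-neg (δ-integral (T m) m) , cₘ≡p*Σtail*-δₘ
  where
  open ≡-Reasoning
  n : ℕ
  n = suc k
  P δₘ Σtail : ℚ
  P = ℕ→ℚ p
  δₘ = δ (T m) m
  tail : Fin n → ℚ
  tail s = c s * Ftail k p s (T s) (basis m)
  Σtail = ΣFin n tail

  tail∈ : ∀ s → ℤSpan c (tail s)
  tail∈ s = gen s *ₛ Ftail-integral k p s (T s) (basis-integral m)

  term-unfold : ∀ s → c s * F n p s (T s) (basis m) ≡ c s * δ (T s) s * basis m s + tail s * P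
  term-unfold s = trans (cong (c s *_) (F-unfold k p s (T s) (basis m)))
    (solve 5 (λ c d e q r → c :* (d :* e :+ q :* r) := c :* d :* e :+ c :* r :* q) refl
      (c s) (δ (T s) s) (basis m s) P (Ftail k p s (T s) (basis m)))

  relation : c m * δₘ + Σtail * P ≡ 0ℚ
  relation = begin
    c m * δₘ + Σtail * P
      ≡⟨ sym (cong₂ _+_ (ΣFin-basis n (λ s → c s * δ (T s) s) m) (ΣFin-*ʳ n tail P)) ⟩
    ΣFin n (λ s → c s * δ (T s) s * basis m s) + ΣFin n (λ s → tail s * P)
      ≡⟨ sym (ΣFin-distrib-+ n (λ s → c s * δ (T s) s * basis m s) (λ s → tail s * P)) ⟩
    ΣFin n (λ s → c s * δ (T s) s * basis m s + tail s * P)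
      ≡⟨ sym (ΣFin-cong n term-unfold) ⟩
    ΣFin n (λ s → c s * F n p s (T s) (basis m))
      ≡⟨ vanishes (basis m) ⟩
    0ℚ
      ∎

  cₘ≡p*Σtail*-δₘ : c m ≡ P * (Σtail * - δₘ)
  cₘ≡p*Σtail*-δₘ = begin
    c m
      ≡⟨ solve 1 (λ c → c := c :* con 1ℚ) refl (c m) ⟩
    c m * 1ℚ
      ≡⟨ cong (c m *_) (sym (δ*δ≡1 (T m) m)) ⟩
    c m * (δₘ * δₘ)
      ≡⟨ solve 4 (λ c d s q → c :* (d :* d) := (c :* d :+ s :* q) :* d :+ q :* (s :* (:- d))) refl (c m) δₘ Σtail P ⟩
    (c m * δₘ + Σtail * P) * δₘ + P * (Σtail * - δₘ)
      ≡⟨ cong (λ r → r * δₘ + P * (Σtail * - δₘ)) relation ⟩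
    0ℚ * δₘ + P * (Σtail * - δₘ)
      ≡⟨ solve 2 (λ d r → con 0ℚ :* d :+ r := r) refl δₘ (P * (Σtail * - δₘ)) ⟩
    P * (Σtail * - δₘ)
      ∎

restrict : ∀ {n} → Subset n → (Fin n → ℚ) → Fin n → ℚ
restrict S c s = if does (s ∈? S) then c s else 0ℚ

restrict-∈ : ∀ {n} {S : Subset n} c {s} → s ∈ S → restrict S c s ≡ c s
restrict-∈ {S = S} c {s} s∈S with s ∈? S
... | yes _   = refl
... | no s∉S  = contradiction s∈S s∉S

restrict-* : ∀ {n} (S : Subset n) c s a → restrict S c s * a ≡ (if does (s ∈? S) then c s * a else 0ℚ)
restrict-* S c s a with does (s ∈? S)
... | true  = refl
... | false = *-zeroˡ a

lemma5p6p3 : (n : ℕ) .{{_ : NonZero n}} (p : ℕ) → Prime p →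
    (S : Subset n) (T : Fin n → Subset n) →
    LinIndepForms n S (λ s → F n p s (T s))
lemma5p6p3 (suc k) p p-prime S T c vanishes s s∈S = begin
  c s                  ≡⟨ sym (restrict-∈ c s∈S) ⟩
  restrict S c s       ≡⟨ ·ℤSpan-generators⇒zero 1<p (vanishing-combination⇒·ℤSpan k p T (restrict S c) vanishes′) s ⟩
  0ℚ                   ∎
  where
  open ≡-Reasoning
  1<p : 1 < p
  1<p = ℕ.nonTrivial⇒n>1 p {{prime⇒nonTrivial p-prime}}
  vanishes′ : ∀ x → ΣFin (suc k) (λ s → restrict S c s * F (suc k) p s (T s) x) ≡ 0ℚ
  vanishes′ x = trans (ΣFin-cong (suc k) (λ s → restrict-* S c s (F (suc k) p s (T s) x))) (vanishes x)
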